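{- For every integer $n\ge 4$, $\mathrm{wdim}_2(K_n\times K_n)=n+\lceil n/3\rceil$.
   Context: $K_n\times K_n$ is the direct product of two complete graphs: vertex set $[n]\times[n]$ with $[n]=\{1,\dots,n\}$, where $(i,j)$ and $(i',j')$ are adjacent iff $i\ne i'$ and $j\ne j'$. With $d$ the shortest-path distance, for $S\subseteq V$ and vertices $x,y,z$: $\Delta_z(x,y)=|d(x,z)-d(y,z)|$ and $\Delta_S(x,y)=\sum_{z\in S}\Delta_z(x,y)$. A set $S$ of vertices is a weak $k$-resolving set if $\Delta_S(x,y)\ge k$ for all distinct vertices $x,y$. The weak $k$-metric dimension $\mathrm{wdim}_k(G)$ is the minimum cardinality of a weak $k$-resolving set of $G$. -}

module Defs where

open import Data.Nat.Base using (ℕ; zero; suc; _+_; _≤_; ∣_-_∣)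
open import Data.Fin.Base using (Fin)
open import Data.Product.Base using (_×_; Σ; _,_)
open import Data.List.Base using (List; map; length)
open import Data.Nat.ListAction using (sum)
open import Data.List.Relation.Unary.Unique.Propositional using (Unique)
open import Relation.Binary.PropositionalEquality using (_≡_; _≢_)

V : ℕ → Set
V n = Fin n × Fin n

Adj : (n : ℕ) → V n → V n → Set
Adj n (i , j) (i′ , j′) = (i ≢ i′) × (j ≢ j′)

data Walk (n : ℕ) : V n → V n → ℕ → Set where
  here : ∀ {x} → Walk n x x zero
  step : ∀ {x y z k} → Adj n x y → Walk n y z k → Walk n x z (suc k)

IsDist : (n : ℕ) → V n → V n → ℕ → Set
IsDist n x y k = Walk n x y k × (∀ j → Walk n x y j → k ≤ j)

IsDistFun : (n : ℕ) → (V n → V n → ℕ) → Set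
IsDistFun n d = ∀ x y → IsDist n x y (d x y)

ΔS : {n : ℕ} → (V n → V n → ℕ) → List (V n) → V n → V n → ℕ
ΔS d S x y = sum (map (λ z → ∣ d x z - d y z ∣) S)

WeakResolving : {n : ℕ} → (V n → V n → ℕ) → ℕ → List (V n) → Set
WeakResolving d k S = Unique S × (∀ x y → x ≢ y → k ≤ ΔS d S x y)

IsWdim : {n : ℕ} → (V n → V n → ℕ) → ℕ → ℕ → Set
IsWdim {n} d k m =
  Σ (List (V n)) (λ S → WeakResolving d k S × length S ≡ m)
  × (∀ S → WeakResolving d k S → m ≤ length S)

module Submission where

-- A vertex set S ⊆ [n] × [n] is recorded by its 0/1 incidence matrix, with row sums R,
-- column sums C and total T = |S|.  For n ≥ 3 two vertices are at distance 0, 1 or 2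
-- according as they agree in both, in neither or in exactly one coordinate, so Δ_S(x, y)
-- is a linear combination of entries, row sums and column sums.
--
-- Comparing two rows through two different columns shows that any two rows
-- (and any two columns) hold at least two elements together; an empty line then already
-- forces T ≥ 2n − 2.  Otherwise let r₁, c₁ count the rows and columns holding exactly one
-- element, and I the isolated elements (alone in their row and their column).  Then
-- T + r₁ ≥ 2n, T + c₁ ≥ 2n and r₁ + c₁ ≤ T + I, so 3T ≥ 4n − I.  The condition for two
-- vertices in different rows and columns rules out two isolated elements; if there is one,
-- either its row is the only singleton row, so T ≥ 2n − 1, or another singleton row meets a
-- column with at least three elements, so T + c₁ ≥ 2n + 1.  Hence 3T ≥ 4n.
--
-- Read the elements as edges between rows and columns.  If they form a
-- spanning forest of stars with at least two leaves each, then every line is occupied,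
-- R i + C j ≥ 2 + m i j for every cell and no rectangle has three occupied corners, which
-- is all the three formulas for Δ_S need.  Block sums of two cherries (four edges on three
-- rows and three columns) with one such forest on 3, 4 or 5 rows give n + ⌈n/3⌉ edges.

open import Defs
open import Data.Fin.Base using (Fin; zero; suc; _↑ˡ_; _↑ʳ_; splitAt)
open import Data.Fin.Patterns using (0F; 1F; 2F; 3F; 4F)
open import Data.Fin.Properties
  using (_≟_; any?; all?; splitAt-↑ˡ; splitAt-↑ʳ; splitAt⁻¹-↑ˡ; splitAt⁻¹-↑ʳ)
import Data.Fin.Properties as Fin
open import Data.List.Base using (List; []; _∷_; map; length; filter; cartesianProduct; allFin)
open import Data.List.Membership.Propositional.Properties
  using (∈-filter⁺; ∈-filter⁻; ∈-cartesianProduct⁺; ∈-allFin)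
open import Data.List.Properties using (map-cong)
open import Data.List.Relation.Unary.All.Properties using (All¬⇒¬Any)
open import Data.List.Relation.Unary.AllPairs using (_∷_)
open import Data.List.Relation.Unary.Any using (here; there)
open import Data.List.Relation.Unary.Unique.Propositional using (Unique)
open import Data.List.Relation.Unary.Unique.Propositional.Properties using (filter⁺; cartesianProduct⁺; allFin⁺)
open import Data.Nat.Base using (ℕ; zero; suc; _+_; _*_; _≤_; _<_; _/_; s≤s; z≤n; ∣_-_∣)
open import Data.Nat.DivMod using (m*n/n≡m; +-distrib-/-∣ˡ; /-monoˡ-≤)
open import Data.Nat.Divisibility using (n∣m*n; ∣-refl)
open import Data.Nat.ListAction using (sum)
open import Data.Nat.Properties hiding (_≟_)
import Data.Nat.Properties as ℕ
open import Algebra.Properties.Semiring.Sum +-*-semiring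
  using (sum-syntax; sum-cong-≗; sum-replicate-zero; ∑-distrib-+; ∑-comm; *-distribˡ-sum; *-distribʳ-sum)
open import Data.Nat.Tactic.RingSolver using (solve-∀)
open import Data.Product.Base using (∃; ∃₂; _×_; _,_; proj₁; proj₂; uncurry)
open import Data.Product.Properties using (≡-dec)
open import Data.Sum.Base using (_⊎_; inj₁; inj₂)
open import Function.Base using (_∘_)
open import Relation.Binary.PropositionalEquality
open import Relation.Nullary using (Dec; yes; no; ¬_; ¬?; contradiction; _×-dec_; _⊎-dec_; _→-dec_)
open import Relation.Nullary.Decidable using (map′; toWitness)

𝟙 : ∀ {P : Set} → Dec P → ℕ
𝟙 (yes _) = 1
𝟙 (no _) = 0

𝟙-yes : ∀ {P : Set} (p? : Dec P) → P → 𝟙 p? ≡ 1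
𝟙-yes (yes _) _ = refl
𝟙-yes (no ¬p) p = contradiction p ¬p

𝟙-no : ∀ {P : Set} (p? : Dec P) → ¬ P → 𝟙 p? ≡ 0
𝟙-no (yes p) ¬p = contradiction p ¬p
𝟙-no (no _) _ = refl

𝟙-⇔ : ∀ {P Q : Set} (p? : Dec P) (q? : Dec Q) → (P → Q) → (Q → P) → 𝟙 p? ≡ 𝟙 q?
𝟙-⇔ (yes p) q? to _ = sym (𝟙-yes q? (to p))
𝟙-⇔ (no ¬p) q? _ from = sym (𝟙-no q? (¬p ∘ from))

𝟙≤1 : ∀ {P : Set} (p? : Dec P) → 𝟙 p? ≤ 1
𝟙≤1 (yes _) = ≤-refl
𝟙≤1 (no _) = z≤n

𝟙+𝟙≤1+𝟙*𝟙 : ∀ {P Q : Set} (p? : Dec P) (q? : Dec Q) → 𝟙 p? + 𝟙 q? ≤ 1 + 𝟙 p? * 𝟙 q?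
𝟙+𝟙≤1+𝟙*𝟙 (yes _) (yes _) = ≤-refl
𝟙+𝟙≤1+𝟙*𝟙 (yes _) (no _) = ≤-refl
𝟙+𝟙≤1+𝟙*𝟙 (no _) (yes _) = ≤-refl
𝟙+𝟙≤1+𝟙*𝟙 (no _) (no _) = z≤n

∑-const : ∀ n c → ∑[ i < n ] c ≡ n * c
∑-const zero c = refl
∑-const (suc n) c = cong (c +_) (∑-const n c)

∑-zero : ∀ {n} {f : Fin n → ℕ} → (∀ i → f i ≡ 0) → ∑[ i < n ] f i ≡ 0
∑-zero {n} f≡0 = trans (sum-cong-≗ f≡0) (sum-replicate-zero n)

∑-supported : ∀ {n} {f : Fin n → ℕ} (a : Fin n) → (∀ i → i ≢ a → f i ≡ 0) → ∑[ i < n ] f i ≡ f a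
∑-supported {f = f} zero off = trans (cong (f zero +_) (∑-zero λ i → off (suc i) λ ())) (+-identityʳ _)
∑-supported (suc a) off =
  cong₂ _+_ (off zero λ ()) (∑-supported a λ i i≢a → off (suc i) (i≢a ∘ Fin.suc-injective))

∑-𝟙 : ∀ {n} (a : Fin n) (f : Fin n → ℕ) → ∑[ i < n ] (𝟙 (a ≟ i) * f i) ≡ f a
∑-𝟙 a f = trans (∑-supported a λ i i≢a → cong (_* f i) (𝟙-no (a ≟ i) (i≢a ∘ sym)))
                (trans (cong (_* f a) (𝟙-yes (a ≟ a) refl)) (*-identityˡ (f a)))

∑-++ : ∀ {a b} (f : Fin (a + b) → ℕ) →
       ∑[ k < a + b ] f k ≡ ∑[ i < a ] f (i ↑ˡ b) + ∑[ j < b ] f (a ↑ʳ j)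
∑-++ {zero} f = refl
∑-++ {suc a} {b} f = trans (cong (f zero +_) (∑-++ {a} {b} (f ∘ suc))) (sym (+-assoc (f zero) _ _))

∑-mono-≤ : ∀ {n} {f g : Fin n → ℕ} → (∀ i → f i ≤ g i) → ∑[ i < n ] f i ≤ ∑[ i < n ] g i
∑-mono-≤ {zero} _ = z≤n
∑-mono-≤ {suc n} f≤g = +-mono-≤ (f≤g zero) (∑-mono-≤ (f≤g ∘ suc))

∑-mono-< : ∀ {n} {f g : Fin n → ℕ} (a : Fin n) → (∀ i → f i ≤ g i) → f a < g a →
           ∑[ i < n ] f i < ∑[ i < n ] g i
∑-mono-< zero f≤g fa<ga = +-mono-<-≤ fa<ga (∑-mono-≤ (f≤g ∘ suc))
∑-mono-< (suc a) f≤g fa<ga = +-mono-≤-< (f≤g zero) (∑-mono-< a (f≤g ∘ suc) fa<ga)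

∑-single : ∀ {n} (f : Fin n → ℕ) (a : Fin n) → f a ≤ ∑[ i < n ] f i
∑-single f zero = m≤m+n _ _
∑-single f (suc a) = ≤-trans (∑-single (f ∘ suc) a) (m≤n+m _ _)

∑-pair : ∀ {n} (f : Fin n → ℕ) {a b : Fin n} → a ≢ b → f a + f b ≤ ∑[ i < n ] f i
∑-pair f {zero} {zero} a≢b = contradiction refl a≢b
∑-pair f {zero} {suc b} _ = +-monoʳ-≤ (f zero) (∑-single (f ∘ suc) b)
∑-pair f {suc a} {zero} _ =
  ≤-trans (≤-reflexive (+-comm (f (suc a)) (f zero))) (+-monoʳ-≤ (f zero) (∑-single (f ∘ suc) a))
∑-pair f {suc a} {suc b} a≢b = ≤-trans (∑-pair (f ∘ suc) (a≢b ∘ cong suc)) (m≤n+m _ _)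

∑-positive : ∀ {n} (f : Fin n → ℕ) → 0 < ∑[ i < n ] f i → ∃ λ i → 0 < f i
∑-positive {suc n} f pos with f zero in eq
... | suc _ = zero , ≤-trans (s≤s z≤n) (≤-reflexive (sym eq))
... | zero with ∑-positive (f ∘ suc) pos
...   | i , fi>0 = suc i , fi>0

∑≤1⇒rest≡0 : ∀ {n} (f : Fin n → ℕ) {a b : Fin n} →
             ∑[ i < n ] f i ≤ 1 → 1 ≤ f a → b ≢ a → f b ≡ 0
∑≤1⇒rest≡0 {n} f {a} {b} ∑≤1 1≤fa b≢a = n≤0⇒n≡0 (+-cancelʳ-≤ 1 (f b) 0 (begin
  f b + 1          ≤⟨ +-monoʳ-≤ (f b) 1≤fa ⟩
  f b + f a        ≤⟨ ∑-pair f b≢a ⟩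
  ∑[ i < n ] f i   ≤⟨ ∑≤1 ⟩
  1                ∎))
  where open ≤-Reasoning

∑≤1⇒unique : ∀ {n} (f : Fin n → ℕ) {a b : Fin n} →
             ∑[ i < n ] f i ≤ 1 → 1 ≤ f a → 1 ≤ f b → a ≡ b
∑≤1⇒unique f {a} {b} ∑≤1 1≤fa 1≤fb with a ≟ b
... | yes a≡b = a≡b
... | no a≢b = contradiction (subst (1 ≤_) (∑≤1⇒rest≡0 f ∑≤1 1≤fb a≢b) 1≤fa) λ ()

-- Distances in K_n × K_n

distFrom : ∀ {A B : Set} → Dec A → Dec B → ℕ
distFrom (yes _) (yes _) = 0
distFrom (no _) (no _) = 1
distFrom _ _ = 2

dist : ∀ {n} → V n → V n → ℕ
dist (i , j) (k , l) = distFrom (i ≟ k) (j ≟ l)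

fresh : ∀ {n} → 3 ≤ n → (a b : Fin n) → ∃ λ c → c ≢ a × c ≢ b
fresh (s≤s (s≤s (s≤s _))) (suc a) (suc b) = 0F , (λ ()) , (λ ())
fresh (s≤s (s≤s (s≤s _))) zero zero = 1F , (λ ()) , (λ ())
fresh (s≤s (s≤s (s≤s _))) zero (suc zero) = 2F , (λ ()) , (λ ())
fresh (s≤s (s≤s (s≤s _))) zero (suc (suc b)) = 1F , (λ ()) , (λ ())
fresh (s≤s (s≤s (s≤s _))) (suc zero) zero = 2F , (λ ()) , (λ ())
fresh (s≤s (s≤s (s≤s _))) (suc (suc a)) zero = 1F , (λ ()) , (λ ())

distinctPair : ∀ {n} → 2 ≤ n → ∃₂ λ (a b : Fin n) → a ≢ b
distinctPair (s≤s (s≤s _)) = 0F , 1F , λ ()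

walk₂ : ∀ {n} → 3 ≤ n → (x y : V n) → Walk n x y 2
walk₂ 3≤n (i , j) (k , l) with fresh 3≤n i k | fresh 3≤n j l
... | c , c≢i , c≢k | e , e≢j , e≢l = step (c≢i ∘ sym , e≢j ∘ sym) (step (c≢k , e≢l) here)

dist-walk : ∀ {n} → 3 ≤ n → (x y : V n) → Walk n x y (dist x y)
dist-walk 3≤n (i , j) (k , l) with i ≟ k | j ≟ l
... | yes refl | yes refl = here
... | no i≢k | no j≢l = step (i≢k , j≢l) here
... | yes _ | no _ = walk₂ 3≤n (i , j) (k , l)
... | no _ | yes _ = walk₂ 3≤n (i , j) (k , l)

dist-self : ∀ {n} (x : V n) → dist x x ≡ 0
dist-self (i , j) with i ≟ i | j ≟ j
... | yes _ | yes _ = refl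
... | no i≢i | _ = contradiction refl i≢i
... | yes _ | no j≢j = contradiction refl j≢j

dist-adj : ∀ {n} {x y : V n} → Adj n x y → dist x y ≡ 1
dist-adj {x = i , j} {k , l} (i≢k , j≢l) with i ≟ k | j ≟ l
... | no _ | no _ = refl
... | yes i≡k | _ = contradiction i≡k i≢k
... | no _ | yes j≡l = contradiction j≡l j≢l

dist≤2 : ∀ {n} (x y : V n) → dist x y ≤ 2
dist≤2 (i , j) (k , l) with i ≟ k | j ≟ l
... | yes _ | yes _ = z≤n
... | yes _ | no _ = ≤-refl
... | no _ | yes _ = ≤-refl
... | no _ | no _ = s≤s z≤n

dist-minimal : ∀ {n} {x y : V n} {k} → Walk n x y k → dist x y ≤ k
dist-minimal {x = x} here = ≤-reflexive (dist-self x)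
dist-minimal (step x~y here) = ≤-reflexive (dist-adj x~y)
dist-minimal {x = x} {y} (step _ (step _ _)) = ≤-trans (dist≤2 x y) (s≤s (s≤s z≤n))

dist-isDist : ∀ {n} → 3 ≤ n → (x y : V n) → IsDist n x y (dist x y)
dist-isDist 3≤n x y = dist-walk 3≤n x y , λ _ → dist-minimal

isDist-unique : ∀ {n} {x y : V n} {k k′} → IsDist n x y k → IsDist n x y k′ → k ≡ k′
isDist-unique (walk , minimal) (walk′ , minimal′) = ≤-antisym (minimal _ walk′) (minimal′ _ walk)

isDistFun⇒≡dist : ∀ {n} {d : V n → V n → ℕ} → 3 ≤ n → IsDistFun n d → ∀ x y → d x y ≡ dist x y
isDistFun⇒≡dist 3≤n isDist x y = isDist-unique (isDist x y) (dist-isDist 3≤n x y)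

-- Incidence matrices and Δ_S

Mat : ℕ → Set
Mat n = Fin n → Fin n → ℕ

module _ {n : ℕ} where

  rowSum : Mat n → Fin n → ℕ
  rowSum m i = ∑[ j < n ] m i j

  colSum : Mat n → Fin n → ℕ
  colSum m j = ∑[ i < n ] m i j

  total : Mat n → ℕ
  total m = ∑[ i < n ] rowSum m i

  total≡∑colSum : (m : Mat n) → total m ≡ ∑[ j < n ] colSum m j
  total≡∑colSum m = ∑-comm m

  rectangleSum : Mat n → Fin n → Fin n → Fin n → Fin n → ℕ
  rectangleSum m i i′ j j′ = m i j + m i j′ + m i′ j + m i′ j′

  infixl 6 _⊞_
  _⊞_ : Mat n → Mat n → Mat n
  (f ⊞ g) k l = f k l + g k l

  cellAt : V n → Mat n
  cellAt (i , j) k l = 𝟙 (i ≟ k) * 𝟙 (j ≟ l)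

  rowAt : Fin n → Mat n
  rowAt i k _ = 𝟙 (i ≟ k)

  colAt : Fin n → Mat n
  colAt j _ l = 𝟙 (j ≟ l)

  -- Opaque, so that a goal ⟪ m , f ⊞ g ⟫ ≡ _ is not unfolded and `_⟨+⟩_` can infer f and g.
  opaque
    ⟪_,_⟫ : Mat n → Mat n → ℕ
    ⟪ m , f ⟫ = ∑[ k < n ] ∑[ l < n ] (m k l * f k l)

  opaque
    unfolding ⟪_,_⟫

    ⟪⟫-comm : (m f : Mat n) → ⟪ m , f ⟫ ≡ ⟪ f , m ⟫
    ⟪⟫-comm m f = sum-cong-≗ λ k → sum-cong-≗ λ l → *-comm (m k l) (f k l)

    ⟪⟫-congˡ : {m m′ : Mat n} (f : Mat n) → (∀ k l → m k l ≡ m′ k l) → ⟪ m , f ⟫ ≡ ⟪ m′ , f ⟫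
    ⟪⟫-congˡ f m≗m′ = sum-cong-≗ λ k → sum-cong-≗ λ l → cong (_* f k l) (m≗m′ k l)

    ⟪⟫-cong : (m : Mat n) {f g : Mat n} → (∀ k l → f k l ≡ g k l) → ⟪ m , f ⟫ ≡ ⟪ m , g ⟫
    ⟪⟫-cong m f≗g = sum-cong-≗ λ k → sum-cong-≗ λ l → cong (m k l *_) (f≗g k l)

    ⟪⟫-zeroˡ : {m f : Mat n} → (∀ k l → m k l ≡ 0) → ⟪ m , f ⟫ ≡ 0
    ⟪⟫-zeroˡ {m} {f} m≡0 = ∑-zero {n} λ k → ∑-zero {n} λ l → cong (_* f k l) (m≡0 k l)

    ⟪⟫-mono : (m : Mat n) {f g : Mat n} → (∀ k l → 1 ≤ m k l → f k l ≤ g k l) →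
              ⟪ m , f ⟫ ≤ ⟪ m , g ⟫
    ⟪⟫-mono m f≤g = ∑-mono-≤ λ k → ∑-mono-≤ λ l → onSupport (m k l) (f≤g k l)
      where
      onSupport : ∀ x {a b} → (1 ≤ x → a ≤ b) → x * a ≤ x * b
      onSupport zero _ = z≤n
      onSupport (suc x) a≤b = *-monoʳ-≤ (suc x) (a≤b (s≤s z≤n))

    ⟪⟫-+ : (m f g : Mat n) → ⟪ m , f ⊞ g ⟫ ≡ ⟪ m , f ⟫ + ⟪ m , g ⟫
    ⟪⟫-+ m f g = trans
      (sum-cong-≗ λ k → trans (sum-cong-≗ λ l → *-distribˡ-+ (m k l) (f k l) (g k l))
                              (∑-distrib-+ (λ l → m k l * f k l) (λ l → m k l * g k l)))
      (∑-distrib-+ (λ k → ∑[ l < n ] (m k l * f k l)) (λ k → ∑[ l < n ] (m k l * g k l)))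

    ⟪⟫-rowwise : (m : Mat n) (g : Fin n → ℕ) → ⟪ m , (λ k _ → g k) ⟫ ≡ ∑[ k < n ] (rowSum m k * g k)
    ⟪⟫-rowwise m g = sum-cong-≗ λ k → sym (*-distribʳ-sum (g k) (m k))

    ⟪⟫-colwise : (m : Mat n) (g : Fin n → ℕ) → ⟪ m , (λ _ l → g l) ⟫ ≡ ∑[ l < n ] (colSum m l * g l)
    ⟪⟫-colwise m g = trans (∑-comm (λ k l → m k l * g l))
                           (sum-cong-≗ λ l → sym (*-distribʳ-sum (g l) (λ k → m k l)))

    ⟪⟫-cell : (m : Mat n) (i j : Fin n) → ⟪ m , cellAt (i , j) ⟫ ≡ m i j
    ⟪⟫-cell m i j = begin
      ∑[ k < n ] ∑[ l < n ] (m k l * (𝟙 (i ≟ k) * 𝟙 (j ≟ l)))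
        ≡⟨ sum-cong-≗ (λ k → trans (sum-cong-≗ λ l → trans (*-comm (m k l) _) (*-assoc (𝟙 (i ≟ k)) _ _))
                                   (sym (*-distribˡ-sum (𝟙 (i ≟ k)) (λ l → 𝟙 (j ≟ l) * m k l)))) ⟩
      ∑[ k < n ] (𝟙 (i ≟ k) * ∑[ l < n ] (𝟙 (j ≟ l) * m k l))
        ≡⟨ sum-cong-≗ (λ k → cong (𝟙 (i ≟ k) *_) (∑-𝟙 j (m k))) ⟩
      ∑[ k < n ] (𝟙 (i ≟ k) * m k j)
        ≡⟨ ∑-𝟙 i (λ k → m k j) ⟩
      m i j ∎
      where open ≡-Reasoning

  infixl 6 _⟨+⟩_
  _⟨+⟩_ : ∀ {m f g : Mat n} {a b} → ⟪ m , f ⟫ ≡ a → ⟪ m , g ⟫ ≡ b → ⟪ m , f ⊞ g ⟫ ≡ a + b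
  _⟨+⟩_ {m} {f} {g} f≡a g≡b = trans (⟪⟫-+ m f g) (cong₂ _+_ f≡a g≡b)

  ⟪⟫-row : (m : Mat n) (i : Fin n) → ⟪ m , rowAt i ⟫ ≡ rowSum m i
  ⟪⟫-row m i = trans (⟪⟫-rowwise m (λ k → 𝟙 (i ≟ k)))
    (trans (sum-cong-≗ λ k → *-comm (rowSum m k) _) (∑-𝟙 i (rowSum m)))

  ⟪⟫-col : (m : Mat n) (j : Fin n) → ⟪ m , colAt j ⟫ ≡ colSum m j
  ⟪⟫-col m j = trans (⟪⟫-colwise m (λ l → 𝟙 (j ≟ l)))
    (trans (sum-cong-≗ λ l → *-comm (colSum m l) _) (∑-𝟙 j (colSum m)))

  ⟪⟫-one : (m : Mat n) → ⟪ m , (λ _ _ → 1) ⟫ ≡ total m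
  ⟪⟫-one m = trans (⟪⟫-rowwise m (λ _ → 1)) (sum-cong-≗ λ k → *-identityʳ (rowSum m k))

  distDiff : V n → V n → Mat n
  distDiff x y k l = ∣ dist x (k , l) - dist y (k , l) ∣

  Δ : Mat n → V n → V n → ℕ
  Δ m x y = ⟪ m , distDiff x y ⟫

  Δ-congˡ : {m m′ : Mat n} → (∀ k l → m k l ≡ m′ k l) → ∀ x y → Δ m x y ≡ Δ m′ x y
  Δ-congˡ m≗m′ x y = ⟪⟫-congˡ (distDiff x y) m≗m′

  Resolving₂ : Mat n → Set
  Resolving₂ m = ∀ x y → x ≢ y → 2 ≤ Δ m x y

  distDiff-sameRow : ∀ {i j j′} → j ≢ j′ → ∀ k l →
    distDiff (i , j) (i , j′) k l ≡ (cellAt (i , j) ⊞ cellAt (i , j′) ⊞ colAt j ⊞ colAt j′) k l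
  distDiff-sameRow {i} {j} {j′} j≢j′ k l with i ≟ k | j ≟ l | j′ ≟ l
  ... | _ | yes refl | yes refl = contradiction refl j≢j′
  ... | yes _ | yes _ | no _ = refl
  ... | yes _ | no _ | yes _ = refl
  ... | yes _ | no _ | no _ = refl
  ... | no _ | yes _ | no _ = refl
  ... | no _ | no _ | yes _ = refl
  ... | no _ | no _ | no _ = refl

  distDiff-sameCol : ∀ {i i′ j} → i ≢ i′ → ∀ k l →
    distDiff (i , j) (i′ , j) k l ≡ (cellAt (i , j) ⊞ cellAt (i′ , j) ⊞ rowAt i ⊞ rowAt i′) k l
  distDiff-sameCol {i} {i′} {j} i≢i′ k l with i ≟ k | i′ ≟ k | j ≟ l
  ... | yes refl | yes refl | _ = contradiction refl i≢i′
  ... | yes _ | no _ | yes _ = refl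
  ... | no _ | yes _ | yes _ = refl
  ... | no _ | no _ | yes _ = refl
  ... | yes _ | no _ | no _ = refl
  ... | no _ | yes _ | no _ = refl
  ... | no _ | no _ | no _ = refl

  distDiff-general : ∀ {i i′ j j′} → i ≢ i′ → j ≢ j′ → ∀ k l →
    (distDiff (i , j) (i′ , j′)
      ⊞ (cellAt (i , j) ⊞ cellAt (i , j′) ⊞ cellAt (i′ , j) ⊞ cellAt (i′ , j′))
      ⊞ (cellAt (i , j′) ⊞ cellAt (i′ , j))) k l
    ≡ (rowAt i ⊞ rowAt i′ ⊞ colAt j ⊞ colAt j′) k l
  distDiff-general {i} {i′} {j} {j′} i≢i′ j≢j′ k l with i ≟ k | i′ ≟ k | j ≟ l | j′ ≟ l
  ... | yes refl | yes refl | _ | _ = contradiction refl i≢i′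
  ... | _ | _ | yes refl | yes refl = contradiction refl j≢j′
  ... | yes _ | no _ | yes _ | no _ = refl
  ... | yes _ | no _ | no _ | yes _ = refl
  ... | yes _ | no _ | no _ | no _ = refl
  ... | no _ | yes _ | yes _ | no _ = refl
  ... | no _ | yes _ | no _ | yes _ = refl
  ... | no _ | yes _ | no _ | no _ = refl
  ... | no _ | no _ | yes _ | no _ = refl
  ... | no _ | no _ | no _ | yes _ = refl
  ... | no _ | no _ | no _ | no _ = refl

  Δ-sameRow : ∀ (m : Mat n) {i j j′} → j ≢ j′ →
    Δ m (i , j) (i , j′) ≡ m i j + m i j′ + colSum m j + colSum m j′
  Δ-sameRow m {i} {j} {j′} j≢j′ = trans (⟪⟫-cong m (distDiff-sameRow {i = i} j≢j′))
    (⟪⟫-cell m i j ⟨+⟩ ⟪⟫-cell m i j′ ⟨+⟩ ⟪⟫-col m j ⟨+⟩ ⟪⟫-col m j′)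

  Δ-sameCol : ∀ (m : Mat n) {i i′ j} → i ≢ i′ →
    Δ m (i , j) (i′ , j) ≡ m i j + m i′ j + rowSum m i + rowSum m i′
  Δ-sameCol m {i} {i′} {j} i≢i′ = trans (⟪⟫-cong m (distDiff-sameCol {j = j} i≢i′))
    (⟪⟫-cell m i j ⟨+⟩ ⟪⟫-cell m i′ j ⟨+⟩ ⟪⟫-row m i ⟨+⟩ ⟪⟫-row m i′)

  Δ-general : ∀ (m : Mat n) {i i′ j j′} → i ≢ i′ → j ≢ j′ →
    Δ m (i , j) (i′ , j′) + rectangleSum m i i′ j j′ + (m i j′ + m i′ j)
      ≡ rowSum m i + rowSum m i′ + colSum m j + colSum m j′
  Δ-general m {i} {i′} {j} {j′} i≢i′ j≢j′ = trans
    (sym (refl ⟨+⟩ (⟪⟫-cell m i j ⟨+⟩ ⟪⟫-cell m i j′ ⟨+⟩ ⟪⟫-cell m i′ j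
                                             ⟨+⟩ ⟪⟫-cell m i′ j′)
               ⟨+⟩ (⟪⟫-cell m i j′ ⟨+⟩ ⟪⟫-cell m i′ j)))
    (trans (⟪⟫-cong m (distDiff-general i≢i′ j≢j′))
           (⟪⟫-row m i ⟨+⟩ ⟪⟫-row m i′ ⟨+⟩ ⟪⟫-col m j ⟨+⟩ ⟪⟫-col m j′))

  _≟V_ : (x y : V n) → Dec (x ≡ y)
  _≟V_ = ≡-dec _≟_ _≟_

  open import Data.List.Membership.DecPropositional _≟V_ using (_∉_; _∈?_)

  χ : List (V n) → Mat n
  χ S k l = 𝟙 ((k , l) ∈? S)

  χ-bit : ∀ S k l → χ S k l ≤ 1
  χ-bit S k l = 𝟙≤1 _

  χ-∷ : ∀ {a S} → a ∉ S → ∀ k l → χ (a ∷ S) k l ≡ (cellAt a ⊞ χ S) k l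
  χ-∷ {i , j} {S} a∉S k l with i ≟ k | j ≟ l
  ... | yes refl | yes refl = trans (𝟙-yes _ (here refl)) (cong suc (sym (𝟙-no _ a∉S)))
  ... | no i≢k | _ =
    𝟙-⇔ _ _ (λ { (here k,l≡a) → contradiction (sym (cong proj₁ k,l≡a)) i≢k
               ; (there k,l∈S) → k,l∈S })
            there
  ... | yes _ | no j≢l =
    𝟙-⇔ _ _ (λ { (here k,l≡a) → contradiction (sym (cong proj₂ k,l≡a)) j≢l
               ; (there k,l∈S) → k,l∈S })
            there

  sum-map≡⟪χ⟫ : ∀ {S} → Unique S → (f : V n → ℕ) → sum (map f S) ≡ ⟪ χ S , (λ k l → f (k , l)) ⟫
  sum-map≡⟪χ⟫ {[]} _ f = sym (⟪⟫-zeroˡ λ _ _ → refl)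
  sum-map≡⟪χ⟫ {a ∷ S} (a≢S ∷ unique) f = begin
    f a + sum (map f S)
      ≡⟨ cong₂ _+_ (sym (⟪⟫-cell f′ _ _)) (trans (sum-map≡⟪χ⟫ unique f) (⟪⟫-comm _ f′)) ⟩
    ⟪ f′ , cellAt a ⟫ + ⟪ f′ , χ S ⟫   ≡⟨ ⟪⟫-+ f′ (cellAt a) (χ S) ⟨
    ⟪ f′ , cellAt a ⊞ χ S ⟫            ≡⟨ ⟪⟫-cong f′ (χ-∷ (All¬⇒¬Any a≢S)) ⟨
    ⟪ f′ , χ (a ∷ S) ⟫                 ≡⟨ ⟪⟫-comm f′ _ ⟩
    ⟪ χ (a ∷ S) , f′ ⟫                 ∎
    where
    open ≡-Reasoning
    f′ : Mat n
    f′ k l = f (k , l)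

  length≡total : ∀ {S} → Unique S → length S ≡ total (χ S)
  length≡total {S} unique =
    trans (length≡sum-map-1 S) (trans (sum-map≡⟪χ⟫ unique (λ _ → 1)) (⟪⟫-one (χ S)))
    where
    length≡sum-map-1 : ∀ {A : Set} (xs : List A) → length xs ≡ sum (map (λ _ → 1) xs)
    length≡sum-map-1 [] = refl
    length≡sum-map-1 (_ ∷ xs) = cong suc (length≡sum-map-1 xs)

  ΔS≡Δχ : ∀ {d : V n → V n → ℕ} → 3 ≤ n → IsDistFun n d →
          ∀ {S} → Unique S → ∀ x y → ΔS d S x y ≡ Δ (χ S) x y
  ΔS≡Δχ 3≤n isDist {S} unique x y = trans
    (cong sum (map-cong (λ z → cong₂ ∣_-_∣ (isDistFun⇒≡dist 3≤n isDist x z)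
                                          (isDistFun⇒≡dist 3≤n isDist y z)) S))
    (sum-map≡⟪χ⟫ unique (λ z → ∣ dist x z - dist y z ∣))

-- The lower bound

singletons : ∀ {n} → (Fin n → ℕ) → ℕ
singletons {n} f = ∑[ i < n ] 𝟙 (f i ℕ.≟ 1)

x+[x≡1]≥2 : ∀ {x} → 1 ≤ x → 2 ≤ x + 𝟙 (x ℕ.≟ 1)
x+[x≡1]≥2 {1} _ = ≤-refl
x+[x≡1]≥2 {suc (suc _)} _ = s≤s (s≤s z≤n)

x*[x≡1]≡[x≡1] : ∀ x → x * 𝟙 (x ℕ.≟ 1) ≡ 𝟙 (x ℕ.≟ 1)
x*[x≡1]≡[x≡1] 0 = refl
x*[x≡1]≡[x≡1] 1 = refl
x*[x≡1]≡[x≡1] (suc (suc x)) = *-zeroʳ (suc (suc x))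

module _ {n : ℕ} (f : Fin n → ℕ) where

  n*2≤∑+singletons : (∀ i → 1 ≤ f i) → n * 2 ≤ ∑[ i < n ] f i + singletons f
  n*2≤∑+singletons 1≤f = begin
    n * 2                              ≡⟨ ∑-const n 2 ⟨
    ∑[ i < n ] 2                       ≤⟨ ∑-mono-≤ (λ i → x+[x≡1]≥2 (1≤f i)) ⟩
    ∑[ i < n ] (f i + 𝟙 (f i ℕ.≟ 1))   ≡⟨ ∑-distrib-+ f _ ⟩
    ∑[ i < n ] f i + singletons f      ∎
    where open ≤-Reasoning

  n*2<∑+singletons : (∀ i → 1 ≤ f i) → ∀ {b} → 3 ≤ f b → n * 2 < ∑[ i < n ] f i + singletons f
  n*2<∑+singletons 1≤f {b} 3≤fb = begin-strict
    n * 2                              ≡⟨ ∑-const n 2 ⟨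
    ∑[ i < n ] 2
      <⟨ ∑-mono-< b (λ i → x+[x≡1]≥2 (1≤f i)) (≤-trans 3≤fb (m≤m+n _ _)) ⟩
    ∑[ i < n ] (f i + 𝟙 (f i ℕ.≟ 1))   ≡⟨ ∑-distrib-+ f _ ⟩
    ∑[ i < n ] f i + singletons f      ∎
    where open ≤-Reasoning

  singletons≤1 : ∀ a → (∀ i → i ≢ a → f i ≢ 1) → singletons f ≤ 1
  singletons≤1 a others≢1 = begin
    singletons f                  ≤⟨ ∑-mono-≤ pointwise ⟩
    ∑[ i < n ] (𝟙 (a ≟ i) * 1)    ≡⟨ ∑-𝟙 a (λ _ → 1) ⟩
    1                             ∎
    where
    open ≤-Reasoning
    pointwise : ∀ i → 𝟙 (f i ℕ.≟ 1) ≤ 𝟙 (a ≟ i) * 1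
    pointwise i with a ≟ i
    ... | yes _ = 𝟙≤1 _
    ... | no a≢i = ≤-reflexive (𝟙-no _ (others≢1 i (a≢i ∘ sym)))

  n*2≤∑+2 : (∀ {i i′} → i ≢ i′ → 2 ≤ f i + f i′) → ∀ {a} → f a ≡ 0 →
            n * 2 ≤ ∑[ i < n ] f i + 2
  n*2≤∑+2 pairs {a} fa≡0 = begin
    n * 2                                         ≡⟨ ∑-const n 2 ⟨
    ∑[ i < n ] 2                                  ≤⟨ ∑-mono-≤ pointwise ⟩
    ∑[ i < n ] (f i + 𝟙 (a ≟ i) * 2)              ≡⟨ ∑-distrib-+ f _ ⟩
    ∑[ i < n ] f i + ∑[ i < n ] (𝟙 (a ≟ i) * 2)   ≡⟨ cong (∑[ i < n ] f i +_) (∑-𝟙 a (λ _ → 2)) ⟩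
    ∑[ i < n ] f i + 2                            ∎
    where
    open ≤-Reasoning
    pointwise : ∀ i → 2 ≤ f i + 𝟙 (a ≟ i) * 2
    pointwise i with a ≟ i
    ... | yes refl = m≤n+m 2 (f a)
    ... | no a≢i = ≤-trans (subst (λ t → 2 ≤ t + f i) fa≡0 (pairs a≢i)) (m≤m+n (f i) 0)

4≤3s⇒2≤s : ∀ s → 4 ≤ s + (s + s) → 2 ≤ s
4≤3s⇒2≤s (suc (suc _)) _ = s≤s (s≤s z≤n)
4≤3s⇒2≤s 0 ()
4≤3s⇒2≤s 1 (s≤s (s≤s (s≤s ())))

2≤r+r′-by-averaging : ∀ {p q p′ q′ r r′} → 2 ≤ p + q + r + r′ → 2 ≤ p′ + q′ + r + r′ →
                      p + p′ ≤ r → q + q′ ≤ r′ → 2 ≤ r + r′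
2≤r+r′-by-averaging {p} {q} {p′} {q′} {r} {r′} h h′ p+p′≤r q+q′≤r′ = 4≤3s⇒2≤s (r + r′) (begin
  4                                             ≤⟨ +-mono-≤ h h′ ⟩
  (p + q + r + r′) + (p′ + q′ + r + r′)         ≡⟨ regroup p q p′ q′ r r′ ⟩
  (p + p′) + (q + q′) + ((r + r′) + (r + r′))   ≤⟨ +-monoˡ-≤ _ (+-mono-≤ p+p′≤r q+q′≤r′) ⟩
  (r + r′) + ((r + r′) + (r + r′))              ∎)
  where
  open ≤-Reasoning
  regroup : ∀ p q p′ q′ r r′ →
            (p + q + r + r′) + (p′ + q′ + r + r′) ≡ (p + p′) + (q + q′) + ((r + r′) + (r + r′))
  regroup = solve-∀

N+N≤t*3 : ∀ {N t r c e} → N ≤ t + r → N + e ≤ t + c → r + c ≤ t + e → N + N ≤ t * 3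
N+N≤t*3 {N} {t} {r} {c} {e} N≤t+r N+e≤t+c r+c≤t+e = +-cancelʳ-≤ e (N + N) (t * 3) (begin
  N + N + e             ≡⟨ +-assoc N N e ⟩
  N + (N + e)           ≤⟨ +-mono-≤ N≤t+r N+e≤t+c ⟩
  (t + r) + (t + c)     ≡⟨ regroup t r c ⟩
  t + t + (r + c)       ≤⟨ +-monoʳ-≤ (t + t) r+c≤t+e ⟩
  t + t + (t + e)       ≡⟨ regroup′ t e ⟩
  t * 3 + e             ∎)
  where
  open ≤-Reasoning
  regroup : ∀ t r c → (t + r) + (t + c) ≡ t + t + (r + c)
  regroup = solve-∀
  regroup′ : ∀ t e → t + t + (t + e) ≡ t * 3 + e
  regroup′ = solve-∀

N≤t+2⇒N+N≤t*3 : ∀ {N t} → 6 ≤ N → N ≤ t + 2 → N + N ≤ t * 3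
N≤t+2⇒N+N≤t*3 {N} {t} 6≤N N≤t+2 = begin
  N + N                 ≤⟨ +-mono-≤ N≤t+2 N≤t+2 ⟩
  (t + 2) + (t + 2)     ≡⟨ regroup t ⟩
  t + t + 4             ≤⟨ +-monoʳ-≤ (t + t) (+-cancelʳ-≤ 2 4 t (≤-trans 6≤N N≤t+2)) ⟩
  t + t + t             ≡⟨ regroup′ t ⟩
  t * 3                 ∎
  where
  open ≤-Reasoning
  regroup : ∀ t → (t + 2) + (t + 2) ≡ t + t + 4
  regroup = solve-∀
  regroup′ : ∀ t → t + t + t ≡ t * 3
  regroup′ = solve-∀

n*4≤m*3⇒n+[n+2]/3≤m : ∀ n m → n * 4 ≤ m * 3 → n + (n + 2) / 3 ≤ m
n*4≤m*3⇒n+[n+2]/3≤m n m n*4≤m*3 = begin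
  n + (n + 2) / 3               ≡⟨ cong (_+ (n + 2) / 3) (m*n/n≡m n 3) ⟨
  n * 3 / 3 + (n + 2) / 3       ≡⟨ +-distrib-/-∣ˡ (n + 2) (n∣m*n n) ⟨
  (n * 3 + (n + 2)) / 3         ≡⟨ cong (_/ 3) (regroup n) ⟩
  (n * 4 + 2) / 3               ≤⟨ /-monoˡ-≤ 3 (+-monoˡ-≤ 2 n*4≤m*3) ⟩
  (m * 3 + 2) / 3               ≡⟨ +-distrib-/-∣ˡ 2 (n∣m*n m) ⟩
  m * 3 / 3 + 2 / 3             ≡⟨ cong (_+ 0) (m*n/n≡m m 3) ⟩
  m + 0                         ≡⟨ +-identityʳ m ⟩
  m                             ∎
  where
  open ≤-Reasoning
  regroup : ∀ n → n * 3 + (n + 2) ≡ n * 4 + 2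
  regroup = solve-∀

antidiagonal≤rectangleSum : ∀ {n} (m : Mat n) i i′ j j′ → m i j′ + m i′ j ≤ rectangleSum m i i′ j j′
antidiagonal≤rectangleSum m i i′ j j′ =
  ≤-trans (≤-trans (m≤n+m _ (m i j)) (≤-reflexive (sym (+-assoc (m i j) _ _)))) (m≤m+n _ (m i′ j′))

module LowerBound {n : ℕ} (3≤n : 3 ≤ n) (m : Mat n) (bit : ∀ i j → m i j ≤ 1) (resolving : Resolving₂ m)
  where

  R C : Fin n → ℕ
  R = rowSum m
  C = colSum m

  T : ℕ
  T = total m

  sameRow : ∀ i {j j′} → j ≢ j′ → 2 ≤ m i j + m i j′ + C j + C j′
  sameRow i {j} {j′} j≢j′ =
    subst (2 ≤_) (Δ-sameRow m {i} j≢j′) (resolving (i , j) (i , j′) (j≢j′ ∘ cong proj₂))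

  sameCol : ∀ {i i′} j → i ≢ i′ → 2 ≤ m i j + m i′ j + R i + R i′
  sameCol {i} {i′} j i≢i′ =
    subst (2 ≤_) (Δ-sameCol m {j = j} i≢i′) (resolving (i , j) (i′ , j) (i≢i′ ∘ cong proj₁))

  general : ∀ {i i′ j j′} → i ≢ i′ → j ≢ j′ →
            2 + (rectangleSum m i i′ j j′ + (m i j′ + m i′ j)) ≤ R i + R i′ + C j + C j′
  general {i} {i′} {j} {j′} i≢i′ j≢j′ = begin
    2 + (rectangleSum m i i′ j j′ + (m i j′ + m i′ j))
      ≤⟨ +-monoˡ-≤ _ (resolving (i , j) (i′ , j′) (i≢i′ ∘ cong proj₁)) ⟩
    Δ m (i , j) (i′ , j′) + (rectangleSum m i i′ j j′ + (m i j′ + m i′ j))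
      ≡⟨ +-assoc (Δ m (i , j) (i′ , j′)) _ _ ⟨
    Δ m (i , j) (i′ , j′) + rectangleSum m i i′ j j′ + (m i j′ + m i′ j)
      ≡⟨ Δ-general m i≢i′ j≢j′ ⟩
    R i + R i′ + C j + C j′ ∎
    where open ≤-Reasoning

  rowPair : ∀ {i i′} → i ≢ i′ → 2 ≤ R i + R i′
  rowPair {i} {i′} i≢i′ with distinctPair (≤-trans (n≤1+n 2) 3≤n)
  ... | a , b , a≢b = 2≤r+r′-by-averaging {m i a} {m i′ a} {m i b} {m i′ b}
    (sameCol a i≢i′) (sameCol b i≢i′) (∑-pair (m i) a≢b) (∑-pair (m i′) a≢b)

  colPair : ∀ {j j′} → j ≢ j′ → 2 ≤ C j + C j′
  colPair {j} {j′} j≢j′ with distinctPair (≤-trans (n≤1+n 2) 3≤n)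
  ... | a , b , a≢b = 2≤r+r′-by-averaging {m a j} {m a j′} {m b j} {m b j′}
    (sameRow a j≢j′) (sameRow b j≢j′) (∑-pair (λ i → m i j) a≢b) (∑-pair (λ i → m i j′) a≢b)

  Isolated : Fin n → Fin n → Set
  Isolated i j = 1 ≤ m i j × R i ≡ 1 × C j ≡ 1

  colSum≥3-besideIsolated : ∀ {i₀ i₁ a b} → i₀ ≢ i₁ → Isolated i₀ a →
                            1 ≤ m i₁ b → R i₁ ≡ 1 → 3 ≤ C b
  colSum≥3-besideIsolated {i₀} {i₁} {a} {b} i₀≢i₁ (occ₀ , R₀ , Ca) occ₁ R₁ with b ≟ a
  ... | yes refl = contradiction (∑≤1⇒unique (λ i → m i a) (≤-reflexive Ca) occ₀ occ₁) i₀≢i₁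
  ... | no b≢a = +-cancelˡ-≤ 3 3 (C b) (begin
    2 + (2 + 2)                             ≤⟨ +-monoʳ-≤ 2 (+-mono-≤ anti≥2 anti≥2) ⟩
    2 + (anti + anti)
      ≤⟨ +-monoʳ-≤ 2 (+-monoˡ-≤ anti (antidiagonal≤rectangleSum m i₀ i₁ b a)) ⟩
    2 + (rectangleSum m i₀ i₁ b a + anti)   ≤⟨ general i₀≢i₁ b≢a ⟩
    R i₀ + R i₁ + C b + C a                 ≡⟨ cong₂ (λ r r′ → r + r′ + C b + C a) R₀ R₁ ⟩
    2 + C b + C a                           ≡⟨ cong (2 + C b +_) Ca ⟩
    2 + C b + 1                             ≡⟨ +-comm (2 + C b) 1 ⟩
    3 + C b                                 ∎)
    where
    open ≤-Reasoning
    anti = m i₀ a + m i₁ b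
    anti≥2 : 2 ≤ anti
    anti≥2 = +-mono-≤ occ₀ occ₁

  isolated-unique : ∀ {i₀ a₀ k l} → Isolated i₀ a₀ → Isolated k l → k ≡ i₀ × l ≡ a₀
  isolated-unique {i₀} {a₀} {k} {l} iso₀@(occ₀ , R₀ , _) (occ , Rk , Cl) with k ≟ i₀
  ... | yes refl = refl , ∑≤1⇒unique (m k) (≤-reflexive R₀) occ occ₀
  ... | no k≢i₀ =
    contradiction (subst (3 ≤_) Cl (colSum≥3-besideIsolated (k≢i₀ ∘ sym) iso₀ occ Rk)) λ { (s≤s ()) }

  rowLeaf colLeaf isolatedCell : Mat n
  rowLeaf k _ = 𝟙 (R k ℕ.≟ 1)
  colLeaf _ l = 𝟙 (C l ℕ.≟ 1)
  isolatedCell k l = rowLeaf k l * colLeaf k l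

  isolatedCount : ℕ
  isolatedCount = ⟪ m , isolatedCell ⟫

  singletons+singletons≤T+isolatedCount : singletons R + singletons C ≤ T + isolatedCount
  singletons+singletons≤T+isolatedCount = begin
    singletons R + singletons C          ≡⟨ rowLeaves ⟨+⟩ colLeaves ⟨
    ⟪ m , rowLeaf ⊞ colLeaf ⟫
      ≤⟨ ⟪⟫-mono m (λ k l _ → 𝟙+𝟙≤1+𝟙*𝟙 (R k ℕ.≟ 1) (C l ℕ.≟ 1)) ⟩
    ⟪ m , (λ _ _ → 1) ⊞ isolatedCell ⟫   ≡⟨ ⟪⟫-one m ⟨+⟩ refl ⟩
    T + isolatedCount                    ∎
    where
    open ≤-Reasoning
    rowLeaves : ⟪ m , rowLeaf ⟫ ≡ singletons R
    rowLeaves = trans (⟪⟫-rowwise m _) (sum-cong-≗ λ k → x*[x≡1]≡[x≡1] (R k))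
    colLeaves : ⟪ m , colLeaf ⟫ ≡ singletons C
    colLeaves = trans (⟪⟫-colwise m _) (sum-cong-≗ λ l → x*[x≡1]≡[x≡1] (C l))

  isolatedCount≤ : (e : Mat n) → (∀ {k l} → Isolated k l → 1 ≤ e k l) → isolatedCount ≤ ⟪ m , e ⟫
  isolatedCount≤ e isolated⇒1≤e = ⟪⟫-mono m pointwise
    where
    pointwise : ∀ k l → 1 ≤ m k l → isolatedCell k l ≤ e k l
    pointwise k l occ with R k ℕ.≟ 1 | C l ℕ.≟ 1
    ... | yes Rk | yes Cl = isolated⇒1≤e (occ , Rk , Cl)
    ... | yes _ | no _ = z≤n
    ... | no _ | _ = z≤n

  isolatedCount≤0 : (∀ k l → ¬ Isolated k l) → isolatedCount ≤ 0
  isolatedCount≤0 none = ≤-trans (isolatedCount≤ (λ _ _ → 0) λ {k} {l} iso → contradiction iso (none k l))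
                                 (≤-reflexive (trans (⟪⟫-comm m _) (⟪⟫-zeroˡ λ _ _ → refl)))

  isolatedCount≤1 : ∀ {i₀ a₀} → Isolated i₀ a₀ → isolatedCount ≤ 1
  isolatedCount≤1 {i₀} {a₀} iso₀ =
    ≤-trans (isolatedCount≤ (cellAt (i₀ , a₀)) atIsolated)
            (≤-trans (≤-reflexive (⟪⟫-cell m i₀ a₀)) (bit i₀ a₀))
    where
    atIsolated : ∀ {k l} → Isolated k l → 1 ≤ cellAt (i₀ , a₀) k l
    atIsolated iso with isolated-unique iso₀ iso
    ... | k≡i₀ , l≡a₀ =
      ≤-reflexive (sym (cong₂ _*_ (𝟙-yes (i₀ ≟ _) (sym k≡i₀)) (𝟙-yes (a₀ ≟ _) (sym l≡a₀))))

  6≤n*2 : 6 ≤ n * 2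
  6≤n*2 = *-monoˡ-≤ 2 3≤n

  module _ (rowsOccupied : ∀ i → 1 ≤ R i) (colsOccupied : ∀ j → 1 ≤ C j) where

    rowBound : n * 2 ≤ T + singletons R
    rowBound = n*2≤∑+singletons R rowsOccupied

    colBound : n * 2 ≤ T + singletons C
    colBound = subst (λ t → n * 2 ≤ t + singletons C) (sym (total≡∑colSum m))
                     (n*2≤∑+singletons C colsOccupied)

    colBound-< : ∀ {b} → 3 ≤ C b → n * 2 < T + singletons C
    colBound-< 3≤Cb = subst (λ t → n * 2 < t + singletons C) (sym (total≡∑colSum m))
                            (n*2<∑+singletons C colsOccupied 3≤Cb)

    linesOccupied⇒bound : n * 2 + n * 2 ≤ T * 3
    linesOccupied⇒bound with any? (λ i → any? (λ j → (1 ≤? m i j) ×-dec (R i ℕ.≟ 1) ×-dec (C j ℕ.≟ 1)))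
    ... | no noneIsolated =
      N+N≤t*3 rowBound (≤-trans (≤-reflexive (+-identityʳ (n * 2))) colBound)
        (≤-trans singletons+singletons≤T+isolatedCount
                 (+-monoʳ-≤ T (isolatedCount≤0 λ k l iso → noneIsolated (k , l , iso))))
    ... | yes (i₀ , a₀ , iso₀) with any? (λ i → ¬? (i ≟ i₀) ×-dec (R i ℕ.≟ 1))
    ...   | no onlyRowI₀ =
      N≤t+2⇒N+N≤t*3 6≤n*2 (≤-trans rowBound (+-monoʳ-≤ T (≤-trans singletonRows≤1 (n≤1+n 1))))
      where
      singletonRows≤1 : singletons R ≤ 1
      singletonRows≤1 = singletons≤1 R i₀ λ i i≢i₀ Ri≡1 → onlyRowI₀ (i , i≢i₀ , Ri≡1)
    ...   | yes (i₁ , i₁≢i₀ , R₁) with ∑-positive (m i₁) (≤-reflexive (sym R₁))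
    ...     | b , occ₁ =
      N+N≤t*3 rowBound
        (≤-trans (≤-reflexive (+-comm (n * 2) 1))
                 (colBound-< (colSum≥3-besideIsolated (i₁≢i₀ ∘ sym) iso₀ occ₁ R₁)))
        (≤-trans singletons+singletons≤T+isolatedCount (+-monoʳ-≤ T (isolatedCount≤1 iso₀)))

  n*4≤T*3 : n * 4 ≤ T * 3
  n*4≤T*3 = subst (_≤ T * 3) (regroup n) bound
    where
    regroup : ∀ n → n * 2 + n * 2 ≡ n * 4
    regroup = solve-∀
    bound : n * 2 + n * 2 ≤ T * 3
    bound with any? (λ i → R i ℕ.≟ 0) | any? (λ j → C j ℕ.≟ 0)
    ... | yes (i , Ri≡0) | _ = N≤t+2⇒N+N≤t*3 6≤n*2 (n*2≤∑+2 R rowPair Ri≡0)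
    ... | no _ | yes (j , Cj≡0) = N≤t+2⇒N+N≤t*3 6≤n*2
      (subst (λ t → n * 2 ≤ t + 2) (sym (total≡∑colSum m)) (n*2≤∑+2 C colPair Cj≡0))
    ... | no noEmptyRow | no noEmptyCol =
      linesOccupied⇒bound (λ i → n≢0⇒n>0 (noEmptyRow ∘ (i ,_))) (λ j → n≢0⇒n>0 (noEmptyCol ∘ (j ,_)))

StarEdge : ℕ → ℕ → Set
StarEdge r c = (r ≡ 1 × 2 ≤ c) ⊎ (c ≡ 1 × 2 ≤ r)

-- Occupied cells, read as edges between rows and columns, form a spanning forest of stars
-- with at least two leaves each.
record IsStarCover {n : ℕ} (m : Mat n) : Set where
  field
    bit : ∀ i j → m i j ≤ 1
    rowOccupied : ∀ i → 1 ≤ rowSum m i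
    colOccupied : ∀ j → 1 ≤ colSum m j
    starEdge : ∀ i j → m i j ≡ 1 → StarEdge (rowSum m i) (colSum m j)

isStarCover? : ∀ {n} (m : Mat n) → Dec (IsStarCover m)
isStarCover? m =
  map′ (λ (b , r , c , e) → record { bit = b ; rowOccupied = r ; colOccupied = c ; starEdge = e })
       (λ cover → let open IsStarCover cover in bit , rowOccupied , colOccupied , starEdge)
       ((all? λ i → all? λ j → m i j ≤? 1) ×-dec (all? λ i → 1 ≤? rowSum m i) ×-dec
        (all? λ j → 1 ≤? colSum m j) ×-dec
        (all? λ i → all? λ j → (m i j ℕ.≟ 1) →-dec starEdge? (rowSum m i) (colSum m j)))
  where
  starEdge? : ∀ r c → Dec (StarEdge r c)
  starEdge? r c = ((r ℕ.≟ 1) ×-dec (2 ≤? c)) ⊎-dec ((c ℕ.≟ 1) ×-dec (2 ≤? r))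

module _ {n : ℕ} {m : Mat n} (cover : IsStarCover m) where

  open IsStarCover cover

  private
    R C : Fin n → ℕ
    R = rowSum m
    C = colSum m

  2+cell≤rowSum+colSum : ∀ i j → 2 + m i j ≤ R i + C j
  2+cell≤rowSum+colSum i j with n≤1⇒n≡0∨n≡1 (bit i j)
  ... | inj₁ mij≡0 rewrite mij≡0 = +-mono-≤ (rowOccupied i) (colOccupied j)
  ... | inj₂ mij≡1 with starEdge i j mij≡1
  ...   | inj₁ (Ri≡1 , 2≤Cj) rewrite mij≡1 | Ri≡1 = s≤s 2≤Cj
  ...   | inj₂ (Cj≡1 , 2≤Ri) rewrite mij≡1 | Cj≡1 = ≤-trans (s≤s 2≤Ri) (≤-reflexive (+-comm 1 (R i)))

  2≤rowSum⇒colSum≡1 : ∀ {i j} → 1 ≤ m i j → 2 ≤ R i → C j ≡ 1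
  2≤rowSum⇒colSum≡1 {i} {j} occ 2≤Ri with starEdge i j (≤-antisym (bit i j) occ)
  ... | inj₁ (Ri≡1 , _) = contradiction (subst (2 ≤_) Ri≡1 2≤Ri) λ { (s≤s ()) }
  ... | inj₂ (Cj≡1 , _) = Cj≡1

  fullRow⇒emptyRow : ∀ {i i′ j j′} → i ≢ i′ → j ≢ j′ →
                     2 ≤ m i j + m i j′ → m i′ j + m i′ j′ ≡ 0
  fullRow⇒emptyRow {i} {i′} {j} {j′} i≢i′ j≢j′ full = cong₂ _+_ (emptyBelow occ) (emptyBelow occ′)
    where
    occ : 1 ≤ m i j
    occ = +-cancelʳ-≤ 1 1 (m i j) (≤-trans full (+-monoʳ-≤ (m i j) (bit i j′)))
    occ′ : 1 ≤ m i j′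
    occ′ = +-cancelˡ-≤ 1 1 (m i j′) (≤-trans full (+-monoˡ-≤ (m i j′) (bit i j)))
    emptyBelow : ∀ {l} → 1 ≤ m i l → m i′ l ≡ 0
    emptyBelow {l} occ-l = ∑≤1⇒rest≡0 (λ k → m k l)
      (≤-reflexive (2≤rowSum⇒colSum≡1 occ-l (≤-trans full (∑-pair (m i) j≢j′)))) occ-l (i≢i′ ∘ sym)

  rectangleSum≤2 : ∀ {i i′ j j′} → i ≢ i′ → j ≢ j′ → rectangleSum m i i′ j j′ ≤ 2
  rectangleSum≤2 {i} {i′} {j} {j′} i≢i′ j≢j′ =
    subst (_≤ 2) (sym (+-assoc (m i j + m i j′) (m i′ j) (m i′ j′))) byRows
    where
    byRows : (m i j + m i j′) + (m i′ j + m i′ j′) ≤ 2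
    byRows with 2 ≤? m i j + m i j′ | 2 ≤? m i′ j + m i′ j′
    ... | yes full | _ rewrite fullRow⇒emptyRow i≢i′ j≢j′ full =
      ≤-trans (≤-reflexive (+-identityʳ _)) (+-mono-≤ (bit i j) (bit i j′))
    ... | no _ | yes full′ rewrite fullRow⇒emptyRow (i≢i′ ∘ sym) j≢j′ full′ =
      +-mono-≤ (bit i′ j) (bit i′ j′)
    ... | no ¬full | no ¬full′ = +-mono-≤ (≤-pred (≰⇒> ¬full)) (≤-pred (≰⇒> ¬full′))

  starCover⇒resolving₂ : Resolving₂ m
  starCover⇒resolving₂ (i , j) (i′ , j′) x≢y with i ≟ i′ | j ≟ j′
  ... | yes refl | yes refl = contradiction refl x≢y
  ... | yes refl | no j≢j′ = subst (2 ≤_) (sym (Δ-sameRow m {i} j≢j′))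
    (≤-trans (+-mono-≤ (colOccupied j) (colOccupied j′)) (+-monoˡ-≤ (C j′) (m≤n+m (C j) _)))
  ... | no i≢i′ | yes refl = subst (2 ≤_) (sym (Δ-sameCol m {j = j} i≢i′))
    (≤-trans (+-mono-≤ (rowOccupied i) (rowOccupied i′)) (+-monoˡ-≤ (R i′) (m≤n+m (R i) _)))
  ... | no i≢i′ | no j≢j′ = +-cancelʳ-≤ W 2 (Δ m (i , j) (i′ , j′)) (begin
    2 + (rectangleSum m i i′ j j′ + anti)
      ≤⟨ +-monoʳ-≤ 2 (+-monoˡ-≤ anti (rectangleSum≤2 i≢i′ j≢j′)) ⟩
    2 + (2 + (m i j′ + m i′ j))             ≡⟨ regroup (m i j′) (m i′ j) ⟩
    (2 + m i j′) + (2 + m i′ j)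
      ≤⟨ +-mono-≤ (2+cell≤rowSum+colSum i j′) (2+cell≤rowSum+colSum i′ j) ⟩
    (R i + C j′) + (R i′ + C j)             ≡⟨ regroup′ (R i) (R i′) (C j) (C j′) ⟩
    R i + R i′ + C j + C j′                 ≡⟨ Δ-general m i≢i′ j≢j′ ⟨
    Δ m (i , j) (i′ , j′) + rectangleSum m i i′ j j′ + anti   ≡⟨ +-assoc (Δ m (i , j) (i′ , j′)) _ _ ⟩
    Δ m (i , j) (i′ , j′) + W               ∎)
    where
    open ≤-Reasoning
    anti = m i j′ + m i′ j
    W = rectangleSum m i i′ j j′ + anti
    regroup : ∀ a b → 2 + (2 + (a + b)) ≡ (2 + a) + (2 + b)
    regroup = solve-∀
    regroup′ : ∀ r r′ c c′ → (r + c′) + (r′ + c) ≡ r + r′ + c + c′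
    regroup′ = solve-∀

-- Block sums and the construction

infixr 5 _⊕_
_⊕_ : ∀ {a b} → Mat a → Mat b → Mat (a + b)
_⊕_ {a} {b} m₁ m₂ k l = block (splitAt a k) (splitAt a l)
  where
  block : Fin a ⊎ Fin b → Fin a ⊎ Fin b → ℕ
  block (inj₁ i) (inj₁ j) = m₁ i j
  block (inj₂ i) (inj₂ j) = m₂ i j
  block _ _ = 0

∀-⊕ : ∀ {a b} {P : Fin (a + b) → Set} → (∀ i → P (i ↑ˡ b)) → (∀ j → P (a ↑ʳ j)) → ∀ k → P k
∀-⊕ {a} {P = P} left right k with splitAt a k in eq
... | inj₁ i = subst P (splitAt⁻¹-↑ˡ eq) (left i)
... | inj₂ j = subst P (splitAt⁻¹-↑ʳ eq) (right j)

module _ {a b : ℕ} (m₁ : Mat a) (m₂ : Mat b) where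

  ⊕-↑ˡ↑ˡ : ∀ i j → (m₁ ⊕ m₂) (i ↑ˡ b) (j ↑ˡ b) ≡ m₁ i j
  ⊕-↑ˡ↑ˡ i j rewrite splitAt-↑ˡ a i b | splitAt-↑ˡ a j b = refl

  ⊕-↑ˡ↑ʳ : ∀ i j → (m₁ ⊕ m₂) (i ↑ˡ b) (a ↑ʳ j) ≡ 0
  ⊕-↑ˡ↑ʳ i j rewrite splitAt-↑ˡ a i b | splitAt-↑ʳ a b j = refl

  ⊕-↑ʳ↑ˡ : ∀ i j → (m₁ ⊕ m₂) (a ↑ʳ i) (j ↑ˡ b) ≡ 0
  ⊕-↑ʳ↑ˡ i j rewrite splitAt-↑ʳ a b i | splitAt-↑ˡ a j b = refl

  ⊕-↑ʳ↑ʳ : ∀ i j → (m₁ ⊕ m₂) (a ↑ʳ i) (a ↑ʳ j) ≡ m₂ i j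
  ⊕-↑ʳ↑ʳ i j rewrite splitAt-↑ʳ a b i | splitAt-↑ʳ a b j = refl

  rowSum-⊕ˡ : ∀ i → rowSum (m₁ ⊕ m₂) (i ↑ˡ b) ≡ rowSum m₁ i
  rowSum-⊕ˡ i = trans (∑-++ {a} {b} _)
    (trans (cong₂ _+_ (sum-cong-≗ (⊕-↑ˡ↑ˡ i)) (∑-zero (⊕-↑ˡ↑ʳ i))) (+-identityʳ _))

  rowSum-⊕ʳ : ∀ i → rowSum (m₁ ⊕ m₂) (a ↑ʳ i) ≡ rowSum m₂ i
  rowSum-⊕ʳ i = trans (∑-++ {a} {b} _) (cong₂ _+_ (∑-zero (⊕-↑ʳ↑ˡ i)) (sum-cong-≗ (⊕-↑ʳ↑ʳ i)))

  colSum-⊕ˡ : ∀ j → colSum (m₁ ⊕ m₂) (j ↑ˡ b) ≡ colSum m₁ j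
  colSum-⊕ˡ j = trans (∑-++ {a} {b} _)
    (trans (cong₂ _+_ (sum-cong-≗ λ i → ⊕-↑ˡ↑ˡ i j) (∑-zero λ i → ⊕-↑ʳ↑ˡ i j)) (+-identityʳ _))

  colSum-⊕ʳ : ∀ j → colSum (m₁ ⊕ m₂) (a ↑ʳ j) ≡ colSum m₂ j
  colSum-⊕ʳ j = trans (∑-++ {a} {b} _)
    (cong₂ _+_ (∑-zero λ i → ⊕-↑ˡ↑ʳ i j) (sum-cong-≗ λ i → ⊕-↑ʳ↑ʳ i j))

  total-⊕ : total (m₁ ⊕ m₂) ≡ total m₁ + total m₂
  total-⊕ = trans (∑-++ {a} {b} _) (cong₂ _+_ (sum-cong-≗ rowSum-⊕ˡ) (sum-cong-≗ rowSum-⊕ʳ))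

  ⊕-isStarCover : IsStarCover m₁ → IsStarCover m₂ → IsStarCover (m₁ ⊕ m₂)
  ⊕-isStarCover cover₁ cover₂ = record
    { bit = ∀-⊕ (λ i → ∀-⊕ (λ j → subst (_≤ 1) (sym (⊕-↑ˡ↑ˡ i j)) (C₁.bit i j))
                           (λ j → subst (_≤ 1) (sym (⊕-↑ˡ↑ʳ i j)) z≤n))
                (λ i → ∀-⊕ (λ j → subst (_≤ 1) (sym (⊕-↑ʳ↑ˡ i j)) z≤n)
                           (λ j → subst (_≤ 1) (sym (⊕-↑ʳ↑ʳ i j)) (C₂.bit i j)))
    ; rowOccupied = ∀-⊕ (λ i → subst (1 ≤_) (sym (rowSum-⊕ˡ i)) (C₁.rowOccupied i))
                        (λ i → subst (1 ≤_) (sym (rowSum-⊕ʳ i)) (C₂.rowOccupied i))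
    ; colOccupied = ∀-⊕ (λ j → subst (1 ≤_) (sym (colSum-⊕ˡ j)) (C₁.colOccupied j))
                        (λ j → subst (1 ≤_) (sym (colSum-⊕ʳ j)) (C₂.colOccupied j))
    ; starEdge = ∀-⊕ (λ i → ∀-⊕ (λ j e → subst₂ StarEdge (sym (rowSum-⊕ˡ i)) (sym (colSum-⊕ˡ j))
                                                         (C₁.starEdge i j (trans (sym (⊕-↑ˡ↑ˡ i j)) e)))
                                (λ j e → contradiction (trans (sym (⊕-↑ˡ↑ʳ i j)) e) λ ()))
                     (λ i → ∀-⊕ (λ j e → contradiction (trans (sym (⊕-↑ʳ↑ˡ i j)) e) λ ())
                                (λ j e → subst₂ StarEdge (sym (rowSum-⊕ʳ i)) (sym (colSum-⊕ʳ j))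
                                                         (C₂.starEdge i j (trans (sym (⊕-↑ʳ↑ʳ i j)) e))))
    }
    where
    module C₁ = IsStarCover cover₁
    module C₂ = IsStarCover cover₂

cherries : Mat 3
cherries 0F 1F = 1
cherries 0F 2F = 1
cherries 1F 0F = 1
cherries 2F 0F = 1
cherries _ _ = 0

claws : Mat 4
claws 0F 0F = 0
claws 0F _ = 1
claws _ 0F = 1
claws _ _ = 0

clawAndCherries : Mat 5
clawAndCherries 0F 1F = 1
clawAndCherries 0F 2F = 1
clawAndCherries 0F 3F = 1
clawAndCherries 1F 0F = 1
clawAndCherries 2F 0F = 1
clawAndCherries 3F 4F = 1
clawAndCherries 4F 4F = 1
clawAndCherries _ _ = 0

stars : ∀ k → Mat (3 + k)
stars 0 = cherries
stars 1 = claws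
stars 2 = clawAndCherries
stars (suc (suc (suc k))) = cherries ⊕ stars k

stars-isStarCover : ∀ k → IsStarCover (stars k)
stars-isStarCover 0 = toWitness {a? = isStarCover? cherries} _
stars-isStarCover 1 = toWitness {a? = isStarCover? claws} _
stars-isStarCover 2 = toWitness {a? = isStarCover? clawAndCherries} _
stars-isStarCover (suc (suc (suc k))) =
  ⊕-isStarCover cherries (stars k) (stars-isStarCover 0) (stars-isStarCover k)

total-stars : ∀ k → total (stars k) ≡ (3 + k) + (3 + k + 2) / 3
total-stars 0 = refl
total-stars 1 = refl
total-stars 2 = refl
total-stars (suc (suc (suc k))) = begin
  total (cherries ⊕ stars k)     ≡⟨ total-⊕ cherries (stars k) ⟩
  4 + total (stars k)            ≡⟨ cong (4 +_) (total-stars k) ⟩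
  4 + ((3 + k) + q)              ≡⟨ regroup k q ⟩
  (6 + k) + (3 / 3 + q)          ≡⟨ cong (6 + k +_) (+-distrib-/-∣ˡ (3 + k + 2) (∣-refl {3})) ⟨
  (6 + k) + (6 + k + 2) / 3      ∎
  where
  open ≡-Reasoning
  q = (3 + k + 2) / 3
  regroup : ∀ k q → 4 + ((3 + k) + q) ≡ (6 + k) + (1 + q)
  regroup = solve-∀

module _ {n : ℕ} (m : Mat n) where

  occupied? : (v : V n) → Dec (uncurry m v ≡ 1)
  occupied? (i , j) = m i j ℕ.≟ 1

  allCells : List (V n)
  allCells = cartesianProduct (allFin n) (allFin n)

  support : List (V n)
  support = filter occupied? allCells

  support-unique : Unique support
  support-unique = filter⁺ occupied? (cartesianProduct⁺ (allFin⁺ n) (allFin⁺ n))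

  χ-support : (∀ i j → m i j ≤ 1) → ∀ i j → χ support i j ≡ m i j
  χ-support bit i j =
    trans (𝟙-⇔ _ (m i j ℕ.≟ 1) (proj₂ ∘ ∈-filter⁻ occupied? {xs = allCells})
                               (∈-filter⁺ occupied? (∈-cartesianProduct⁺ (∈-allFin i) (∈-allFin j))))
          (𝟙[x≡1]≡x (bit i j))
    where
    𝟙[x≡1]≡x : ∀ {x} → x ≤ 1 → 𝟙 (x ℕ.≟ 1) ≡ x
    𝟙[x≡1]≡x z≤n = refl
    𝟙[x≡1]≡x (s≤s z≤n) = refl

module _ {n : ℕ} {d : V n → V n → ℕ} (3≤n : 3 ≤ n) (isDist : IsDistFun n d) where

  starCover⇒weakResolving : ∀ {m} → IsStarCover m → WeakResolving d 2 (support m)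
  starCover⇒weakResolving {m} cover = support-unique m , λ x y x≢y →
    subst (2 ≤_) (sym (trans (ΔS≡Δχ 3≤n isDist (support-unique m) x y) (Δ-congˡ (χ-support m bit) x y)))
          (starCover⇒resolving₂ cover x y x≢y)
    where open IsStarCover cover

  length-support : ∀ {m : Mat n} → (∀ i j → m i j ≤ 1) → length (support m) ≡ total m
  length-support {m} bit =
    trans (length≡total (support-unique m)) (sum-cong-≗ λ i → sum-cong-≗ λ j → χ-support m bit i j)

  weakResolving⇒n+[n+2]/3≤length : ∀ {S} → WeakResolving d 2 S → n + (n + 2) / 3 ≤ length S
  weakResolving⇒n+[n+2]/3≤length {S} (unique , resolves) = subst (n + (n + 2) / 3 ≤_) (sym (length≡total unique))
    (n*4≤m*3⇒n+[n+2]/3≤m n _ (LowerBound.n*4≤T*3 3≤n (χ S) (χ-bit S) resolving))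
    where
    resolving : Resolving₂ (χ S)
    resolving x y x≢y = subst (2 ≤_) (ΔS≡Δχ 3≤n isDist unique x y) (resolves x y x≢y)

mainTheorem3 : (n : ℕ) → 4 ≤ n → (d : V n → V n → ℕ) → IsDistFun n d →
    IsWdim d 2 (n + (n + 2) / 3)
mainTheorem3 _ (s≤s (s≤s (s≤s {n = k} _))) d isDist =
  ( support (stars k)
  , starCover⇒weakResolving 3≤n isDist cover
  , trans (length-support 3≤n isDist (IsStarCover.bit cover)) (total-stars k) )
  , λ _ → weakResolving⇒n+[n+2]/3≤length 3≤n isDist
  where
  3≤n : 3 ≤ 3 + k
  3≤n = s≤s (s≤s (s≤s z≤n))
  cover : IsStarCover (stars k)
  cover = stars-isStarCover k
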